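{- Let $F$ be a forest with $t$ edges in the complete graph $K_n$. Then the number of spanning trees of $K_n$ that contain $F$ is at least $n^{n-t-2}$. -}

module Defs where

open import Data.Nat using (ℕ; zero; suc; _+_; _<ᵇ_)
open import Data.Bool using (Bool; true; false; if_then_else_; _∧_)
open import Data.Fin using (Fin; zero; suc; toℕ; inject₁; fromℕ)
open import Data.Product using (Σ; _×_; ∃-syntax)
open import Relation.Binary.PropositionalEquality using (_≡_; _≢_)
open import Relation.Binary.Construct.Closure.ReflexiveTransitive using (Star)
open import Relation.Nullary using (¬_)
open import Function.Definitions using (Injective)

-- A graph on the vertex set Fin n (the vertex set of K_n), given by its
-- adjacency function.  Every simple graph on Fin n is a subgraph of K_n.
Graph : ℕ → Set
Graph n = Fin n → Fin n → Bool

IsSimple : ∀ {n} → Graph n → Set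
IsSimple {n} G = (∀ (i j : Fin n) → G i j ≡ G j i) × (∀ (i : Fin n) → G i i ≡ false)

Adj : ∀ {n} → Graph n → Fin n → Fin n → Set
Adj G u v = G u v ≡ true

HasCycle : ∀ {n} → Graph n → Set
HasCycle {n} G =
  ∃[ k ] Σ (Fin (3 + k) → Fin n) λ c → (Injective _≡_ _≡_ c
     × (∀ (i : Fin (suc (suc k))) → Adj G (c (inject₁ i)) (c (suc i)))
     × Adj G (c (fromℕ (suc (suc k)))) (c zero))

Acyclic : ∀ {n} → Graph n → Set
Acyclic G = ¬ HasCycle G

Connected : ∀ {n} → Graph n → Set
Connected {n} G = ∀ (u v : Fin n) → Star (Adj G) u v

IsForest : ∀ {n} → Graph n → Set
IsForest G = IsSimple G × Acyclic G

IsSpanningTree : ∀ {n} → Graph n → Set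
IsSpanningTree G = IsSimple G × Connected G × Acyclic G

_⊆ᴳ_ : ∀ {n} → Graph n → Graph n → Set
_⊆ᴳ_ {n} F T = ∀ (i j : Fin n) → F i j ≡ true → T i j ≡ true

Differ : ∀ {n} → Graph n → Graph n → Set
Differ {n} A B = ∃[ i ] ∃[ j ] (A i j ≢ B i j)

sumFin : ∀ {m} → (Fin m → ℕ) → ℕ
sumFin {zero} f = 0
sumFin {suc m} f = f zero + sumFin (λ i → f (suc i))

edgeCount : ∀ {n} → Graph n → ℕ
edgeCount G = sumFin (λ i → sumFin (λ j →
  if (toℕ i <ᵇ toℕ j) ∧ G i j then 1 else 0))

{-# OPTIONS --safe #-}
module Submission where

-- Describe F by parent pointers: a rooted forest with one root per component of F (built by
-- deleting leaves one at a time), hence with at least n - t roots.  Fix a root ρ, take another root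
-- v, hang it below any vertex x outside its own tree, and recurse until ρ is the only root.
-- Different choices of x end in different spanning trees, because in a tree rooted at ρ the parent
-- of v is determined by the graph.  If the tree of ρ has u vertices, the tree of v has b, and there
-- are R + 1 roots, the number N of trees obtained satisfies u · n ^ R ≤ n · N by induction on R:
-- hanging v below x leaves a tree of ρ of size u + b when x lies in it and of size u otherwise, and
-- summing over the n - b admissible x gives u · n.  As u ≥ 1 and R + 1 ≥ n - t, N ≥ n ^ (n - t - 2).

open import Defs
open import Data.Bool using (Bool; true; false; if_then_else_; _∧_; not)
import Data.Bool as Bool
open import Data.Bool.Properties using (∨-comm; ∧-identityʳ; ∧-zeroʳ)
open import Data.Empty using (⊥; ⊥-elim)
open import Data.Fin using (Fin; zero; suc; toℕ; inject₁; inject≤; fromℕ; splitAt; join; _≟_)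
open import Data.Fin.Properties
  using (suc-injective; toℕ-injective; toℕ<n; toℕ-inject₁; toℕ-fromℕ; inject≤-injective;
         join-splitAt; pigeonhole; any?; all?)
open import Data.Fin.Relation.Unary.Top using (view; ‵fromℕ; ‵inject₁)
open import Data.Nat
  using (ℕ; zero; suc; pred; _+_; _*_; _^_; _∸_; _≤_; _<_; z≤n; s≤s; s≤s⁻¹; _<ᵇ_;
         NonZero; >-nonZero)
open import Data.Nat.GeneralisedArithmetic using (iterate)
open import Data.Nat.Induction using (<-wellFounded; <-rec)
open import Data.Nat.Properties
  using (module ≤-Reasoning; +-commutativeSemigroup; _≤?_; _<?_; <-cmp; anyUpTo?;
         ≤-refl; ≤-reflexive; ≤-trans; <-irrefl; <-asym; <⇒≢; <⇒≱; ≰⇒≥; n<1+n;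
         m≤m+n; m≤n+m; m≤n⇒∃[o]m+o≡n; suc-pred; m+n∸n≡m;
         +-comm; +-suc; +-identityʳ; +-cancelˡ-≡; +-mono-≤; +-monoʳ-≤; +-monoˡ-<;
         *-comm; *-assoc; *-identityˡ; *-identityʳ; *-zeroʳ; *-distribˡ-+; *-monoˡ-≤; *-cancelˡ-≤;
         ^-monoʳ-≤; ∸-monoˡ-≤)
open import Algebra.Properties.CommutativeSemigroup +-commutativeSemigroup
  using () renaming (interchange to +-interchange)
open import Data.Product using (Σ; _×_; _,_; proj₁; proj₂; ∃; ∃₂; uncurry)
import Data.Product
open import Data.Sum using (_⊎_; inj₁; inj₂; [_,_]′)
import Data.Sum
open import Function using (_∘_; id; flip)
open import Function.Bundles using (_⇔_; mk⇔)
open import Induction.WellFounded using (module All)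
open import Level using (Level)
open import Relation.Binary.Core using (Rel)
open import Relation.Binary.Construct.Closure.ReflexiveTransitive using (Star; ε; _◅_; _◅◅_; reverse)
import Relation.Binary.Construct.On as On
open import Relation.Binary.Definitions using (Symmetric; tri<; tri≈; tri>)
open import Relation.Binary.PropositionalEquality
open import Relation.Nullary
  using (¬_; Dec; yes; no; does; contradiction; ¬?; _×-dec_; _⊎-dec_; _→-dec_)
open import Relation.Nullary.Decidable using (dec-true; dec-false; does-⇔; decidable-stable)
open import Relation.Unary using (Pred; Decidable)

private variable
  ℓ ℓ′ : Level
  A : Set ℓ
  n m : ℕ

does-true⇒ : (a? : Dec A) → does a? ≡ true → A
does-true⇒ (yes a) _ = a

if-yes : {B : Set} {x y : B} (a? : Dec A) → A → (if does a? then x else y) ≡ x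
if-yes (yes _) _ = refl
if-yes (no ¬a) a = contradiction a ¬a

if-no : {B : Set} {x y : B} (a? : Dec A) → ¬ A → (if does a? then x else y) ≡ y
if-no (yes a) ¬a = contradiction a ¬a
if-no (no _)  _  = refl

-- Finite sums and counting

sumFin-cong : {f g : Fin m → ℕ} → (∀ i → f i ≡ g i) → sumFin f ≡ sumFin g
sumFin-cong {m = zero}  _   = refl
sumFin-cong {m = suc m} f≗g = cong₂ _+_ (f≗g zero) (sumFin-cong (f≗g ∘ suc))

sumFin-mono : {f g : Fin m → ℕ} → (∀ i → f i ≤ g i) → sumFin f ≤ sumFin g
sumFin-mono {m = zero}  _   = z≤n
sumFin-mono {m = suc m} f≤g = +-mono-≤ (f≤g zero) (sumFin-mono (f≤g ∘ suc))

sumFin-+ : (f g : Fin m → ℕ) → sumFin (λ i → f i + g i) ≡ sumFin f + sumFin g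
sumFin-+ {m = zero}  f g = refl
sumFin-+ {m = suc m} f g =
  trans (cong (f zero + g zero +_) (sumFin-+ (f ∘ suc) (g ∘ suc))) (+-interchange (f zero) (g zero) _ _)

sumFin-*ˡ : (c : ℕ) (f : Fin m → ℕ) → sumFin (λ i → c * f i) ≡ c * sumFin f
sumFin-*ˡ {m = zero}  c f = sym (*-zeroʳ c)
sumFin-*ˡ {m = suc m} c f =
  trans (cong (c * f zero +_) (sumFin-*ˡ c (f ∘ suc))) (sym (*-distribˡ-+ c (f zero) _))

sumFin-*ʳ : (f : Fin m → ℕ) (c : ℕ) → sumFin (λ i → f i * c) ≡ sumFin f * c
sumFin-*ʳ f c =
  trans (sumFin-cong (λ i → *-comm (f i) c)) (trans (sumFin-*ˡ c f) (*-comm c (sumFin f)))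

sumFin-const : ∀ m (c : ℕ) → sumFin {m} (λ _ → c) ≡ m * c
sumFin-const zero    c = refl
sumFin-const (suc m) c = cong (c +_) (sumFin-const m c)

sumFin-≥ : (f : Fin m → ℕ) (a : Fin m) → f a ≤ sumFin f
sumFin-≥ f zero    = m≤m+n _ _
sumFin-≥ f (suc a) = ≤-trans (sumFin-≥ (f ∘ suc) a) (m≤n+m _ _)

sumFin-suc-at : {f g : Fin m → ℕ} (a : Fin m) → f a ≡ suc (g a) →
                (∀ i → i ≢ a → f i ≡ g i) → sumFin f ≡ suc (sumFin g)
sumFin-suc-at zero    at off = cong₂ _+_ at (sumFin-cong (λ i → off (suc i) λ ()))
sumFin-suc-at {g = g} (suc a) at off =
  trans (cong₂ _+_ (off zero λ ()) (sumFin-suc-at a at λ i i≢a → off (suc i) (i≢a ∘ suc-injective)))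
        (+-suc (g zero) _)

indicator : Bool → ℕ
indicator b = if b then 1 else 0

count : {P : Pred (Fin m) ℓ} → Decidable P → ℕ
count P? = sumFin (λ i → indicator (does (P? i)))

module _ {P : Pred (Fin m) ℓ} (P? : Decidable P) where

  count-≥1 : ∀ i → P i → 1 ≤ count P?
  count-≥1 i p = ≤-trans (≤-reflexive (sym (if-yes (P? i) p))) (sumFin-≥ _ i)

  count-≤ : count P? ≤ m
  count-≤ = ≤-trans (sumFin-mono indicator≤1) (≤-reflexive (trans (sumFin-const m 1) (*-identityʳ m)))
    where
    indicator≤1 : ∀ i → indicator (does (P? i)) ≤ 1
    indicator≤1 i with does (P? i)
    ... | true  = ≤-refl
    ... | false = z≤n

  count-mono : {Q : Pred (Fin m) ℓ′} (Q? : Decidable Q) → (∀ i → P i → Q i) →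
               count P? ≤ count Q?
  count-mono Q? P⊆Q = sumFin-mono pointwise
    where
    pointwise : ∀ i → indicator (does (P? i)) ≤ indicator (does (Q? i))
    pointwise i with P? i | Q? i
    ... | yes p | no ¬q = contradiction (P⊆Q i p) ¬q
    ... | yes _ | yes _ = ≤-refl
    ... | no _  | _     = z≤n

  count-suc-at : {Q : Pred (Fin m) ℓ′} (Q? : Decidable Q) (a : Fin m) → P a → ¬ Q a →
                 (∀ i → i ≢ a → P i ⇔ Q i) → count P? ≡ suc (count Q?)
  count-suc-at Q? a p ¬q P⇔Q =
    sumFin-suc-at a (trans (if-yes (P? a) p) (cong suc (sym (if-no (Q? a) ¬q))))
                    (λ i i≢a → cong indicator (does-⇔ (P⇔Q i i≢a) (P? i) (Q? i)))

  count-all : (∀ i → P i) → count P? ≡ m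
  count-all all = trans (sumFin-cong λ i → cong indicator (dec-true (P? i) (all i)))
                        (trans (sumFin-const m 1) (*-identityʳ m))

  count-complement : count P? + count (¬? ∘ P?) ≡ m
  count-complement = begin
    count P? + count (¬? ∘ P?)
      ≡⟨ sumFin-+ (indicator ∘ does ∘ P?) (indicator ∘ not ∘ does ∘ P?) ⟨
    sumFin (λ i → indicator (does (P? i)) + indicator (not (does (P? i))))
      ≡⟨ sumFin-cong pointwise ⟩
    sumFin {m} (λ _ → 1)
      ≡⟨ trans (sumFin-const m 1) (*-identityʳ m) ⟩
    m ∎
    where
    open ≡-Reasoning
    pointwise : ∀ i → indicator (does (P? i)) + indicator (not (does (P? i))) ≡ 1
    pointwise i with does (P? i)
    ... | true  = refl
    ... | false = refl

count-≟ : (a : Fin m) → count (_≟ a) ≡ 1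
count-≟ {m} a =
  trans (count-suc-at (_≟ a) (λ _ → no id) a refl id (λ i i≢a → mk⇔ i≢a ⊥-elim))
        (cong suc (trans (sumFin-const m 0) (*-zeroʳ m)))

count-≤1 : {P : Pred (Fin m) ℓ} (P? : Decidable P) (a : Fin m) → (∀ i → P i → i ≡ a) →
           count P? ≤ 1
count-≤1 P? a unique = ≤-trans (count-mono P? (_≟ a) unique) (≤-reflexive (count-≟ a))

count-≥2 : {P : Pred (Fin m) ℓ} (P? : Decidable P) {a b : Fin m} → P a → P b → a ≢ b →
           2 ≤ count P?
count-≥2 {P = P} P? {a} {b} pa pb a≢b =
  subst (2 ≤_) (sym count≡) (s≤s (count-≥1 P∖a? b (pb , a≢b ∘ sym)))
  where
  P∖a? : Decidable (λ i → P i × i ≢ a)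
  P∖a? i = P? i ×-dec ¬? (i ≟ a)
  count≡ : count P? ≡ suc (count P∖a?)
  count≡ = count-suc-at P? P∖a? a pa (λ (_ , a≢a) → a≢a refl) (λ i i≢a → mk⇔ (_, i≢a) proj₁)

argmax : (f : Fin (suc m) → ℕ) → ∃ λ a → ∀ i → f i ≤ f a
argmax {zero}  f = zero , λ { zero → ≤-refl }
argmax {suc m} f with argmax (f ∘ suc)
... | a , max with f zero ≤? f (suc a)
...   | yes f0≤ = suc a , λ { zero → f0≤ ; (suc i) → max i }
...   | no  f0≰ = zero  , λ { zero → ≤-refl ; (suc i) → ≤-trans (max i) (≰⇒≥ f0≰) }

module _ {R : Rel A ℓ′} (R-sym : Symmetric R) (k : ℕ) (c : Fin (3 + k) → A)
         (step : ∀ (i : Fin (2 + k)) → R (c (inject₁ i)) (c (suc i)))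
         (close : R (c (fromℕ (2 + k))) (c zero)) where

  cycle-neighbours : ∀ i → ∃₂ λ a b → a ≢ b × R (c i) (c a) × R (c i) (c b)
  cycle-neighbours zero = suc zero , fromℕ (2 + k) , (λ ()) , step zero , R-sym close
  cycle-neighbours (suc t) with view t
  ... | ‵fromℕ      = inject₁ t , zero , (λ ()) , R-sym (step t) , close
  ... | ‵inject₁ t′ =
    inject₁ t , suc (suc t′) , inject₁²≢suc² t′ , R-sym (step t) , step (suc t′)
    where
    inject₁²≢suc² : ∀ {k} (i : Fin k) → inject₁ (inject₁ i) ≢ suc (suc i)
    inject₁²≢suc² zero    ()
    inject₁²≢suc² (suc i) = inject₁²≢suc² i ∘ suc-injective

Separated : Rel A ℓ → ∀ {N} → (Fin N → A) → Set ℓ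
Separated R f = ∀ k l → k ≢ l → R (f k) (f l)

unflatten : (N : Fin m → ℕ) → Fin (sumFin N) → Σ (Fin m) (Fin ∘ N)
unflatten {suc m} N =
  [ (zero ,_) , Data.Product.map suc id ∘ unflatten (N ∘ suc) ]′ ∘ splitAt (N zero)

unflatten-injective : (N : Fin m → ℕ) {k l : Fin (sumFin N)} →
                      unflatten N k ≡ unflatten N l → k ≡ l
unflatten-injective {suc m} N {k} {l} eq =
  trans (sym (join-splitAt (N zero) _ k))
        (trans (cong (join (N zero) _) (cases-injective (splitAt (N zero) k) (splitAt (N zero) l) eq))
               (join-splitAt (N zero) _ l))
  where
  cases : Fin (N zero) ⊎ Fin (sumFin (N ∘ suc)) → Σ (Fin (suc m)) (Fin ∘ N)
  cases = [ (zero ,_) , Data.Product.map suc id ∘ unflatten (N ∘ suc) ]′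
  map-suc-injective : ∀ {p q : Σ (Fin m) (Fin ∘ N ∘ suc)} →
                      Data.Product.map suc id p ≡ Data.Product.map suc id q → p ≡ q
  map-suc-injective refl = refl
  cases-injective : ∀ p q → cases p ≡ cases q → p ≡ q
  cases-injective (inj₁ i) (inj₁ j) refl = refl
  cases-injective (inj₁ i) (inj₂ j) eq   = contradiction (cong proj₁ eq) λ ()
  cases-injective (inj₂ i) (inj₁ j) eq   = contradiction (cong proj₁ eq) λ ()
  cases-injective (inj₂ i) (inj₂ j) eq   =
    cong inj₂ (unflatten-injective (N ∘ suc) (map-suc-injective eq))

concat-separated : {R : Rel A ℓ} (N : Fin m → ℕ) (f : ∀ x → Fin (N x) → A) →
                   (∀ x → Separated R (f x)) → (∀ {x y} i j → x ≢ y → R (f x i) (f y j)) →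
                   Separated R (uncurry f ∘ unflatten N)
concat-separated {R = R} N f inner outer k l k≢l =
  pairs (unflatten N k) (unflatten N l) (k≢l ∘ unflatten-injective N)
  where
  pairs : ∀ p q → p ≢ q → R (uncurry f p) (uncurry f q)
  pairs (x , i) (y , j) p≢q with x ≟ y
  ... | yes refl = inner x i j (p≢q ∘ cong (x ,_))
  ... | no  x≢y  = outer i j x≢y

iterate-+ : (f : A → A) (x : A) (i t : ℕ) → iterate f x (i + t) ≡ iterate f (iterate f x i) t
iterate-+ f x zero    t = refl
iterate-+ f x (suc i) t = iterate-+ f (f x) i t

least-witness : {P : Pred ℕ ℓ} → Decidable P → ∀ {j} → P j →
                ∃ λ k → P k × (∀ {i} → i < k → ¬ P i)
least-witness {P = P} P? {j} = <-rec (λ j → P j → Least) step j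
  where
  Least : Set _
  Least = ∃ λ k → P k × (∀ {i} → i < k → ¬ P i)
  step : ∀ j → (∀ {i} → i < j → P i → Least) → P j → Least
  step j smaller pj with anyUpTo? P? j
  ... | yes (i , i<j , pi) = smaller i<j pi
  ... | no  none           = j , pj , λ i<j pi → none (_ , i<j , pi)

-- Rooted forests

-- root and depth are stored, not computed from parent; WellFormed ties them to parent, and depth
-- is the measure that makes following parents terminate.
record RootedForest (n : ℕ) : Set where
  field
    parent root : Fin n → Fin n
    depth       : Fin n → ℕ
open RootedForest

IsRoot : RootedForest n → Pred (Fin n) _
IsRoot S w = root S w ≡ w

isRoot? : (S : RootedForest n) → Decidable (IsRoot S)
isRoot? S w = root S w ≟ w

record WellFormed (S : RootedForest n) : Set where
  field
    root-isRoot  : ∀ w → IsRoot S (root S w)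
    root-parent  : ∀ {w} → ¬ IsRoot S w → root S (parent S w) ≡ root S w
    depth-parent : ∀ {w} → ¬ IsRoot S w → depth S (parent S w) < depth S w
open WellFormed

ChildOf : RootedForest n → Fin n → Fin n → Set
ChildOf S u v = ¬ IsRoot S u × parent S u ≡ v

TreeEdge : RootedForest n → Fin n → Fin n → Set
TreeEdge S u v = ChildOf S u v ⊎ ChildOf S v u

childOf? : (S : RootedForest n) (u v : Fin n) → Dec (ChildOf S u v)
childOf? S u v = ¬? (isRoot? S u) ×-dec (parent S u ≟ v)

treeEdge? : (S : RootedForest n) (u v : Fin n) → Dec (TreeEdge S u v)
treeEdge? S u v = childOf? S u v ⊎-dec childOf? S v u

graph : RootedForest n → Graph n
graph S u v = does (treeEdge? S u v)

roots : RootedForest n → ℕ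
roots S = count (isRoot? S)

treeSize : RootedForest n → Fin n → ℕ
treeSize S z = count (λ w → root S w ≟ z)

module _ (S : RootedForest n) {u v : Fin n} where

  graph⇒treeEdge : Adj (graph S) u v → TreeEdge S u v
  graph⇒treeEdge = does-true⇒ (treeEdge? S u v)

  treeEdge⇒graph : TreeEdge S u v → Adj (graph S) u v
  treeEdge⇒graph = dec-true (treeEdge? S u v)

  graph-sym : graph S u v ≡ graph S v u
  graph-sym = ∨-comm (does (childOf? S u v)) (does (childOf? S v u))

adj-sym : (S : RootedForest n) → Symmetric (Adj (graph S))
adj-sym S {u} {v} = trans (graph-sym S {v} {u})

module _ {S : RootedForest n} (wf : WellFormed S) where

  parent-induction : (P : Pred (Fin n) ℓ) → (∀ w → (¬ IsRoot S w → P (parent S w)) → P w) →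
                     ∀ w → P w
  parent-induction P step =
    All.wfRec (On.wellFounded (depth S) <-wellFounded) _ P (λ w rec → step w (rec ∘ depth-parent wf))

  graph-loopless : ∀ w → graph S w w ≡ false
  graph-loopless w = dec-false (treeEdge? S w w) [ not-own-child , not-own-child ]′
    where
    not-own-child : ¬ ChildOf S w w
    not-own-child (¬root , p≡w) = <⇒≢ (depth-parent wf ¬root) (cong (depth S) p≡w)

  graph-isSimple : IsSimple (graph S)
  graph-isSimple = (λ u v → graph-sym S) , graph-loopless

  neighbour-parent : ∀ {x y} → Adj (graph S) x y → depth S y ≤ depth S x → parent S x ≡ y
  neighbour-parent xy y≤x with graph⇒treeEdge S xy
  ... | inj₁ (_ , p≡y)  = p≡y
  ... | inj₂ (¬r , p≡x) =
    contradiction y≤x (<⇒≱ (subst (λ z → depth S z < _) p≡x (depth-parent wf ¬r)))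

  -- Both cycle-neighbours of a deepest vertex of the cycle would have to be its parent.
  graph-acyclic : Acyclic (graph S)
  graph-acyclic (k , c , c-inj , step , close)
    with top , deepest ← argmax (depth S ∘ c)
    with a , b , a≢b , top-a , top-b ← cycle-neighbours {R = Adj (graph S)} (adj-sym S) k c step close top
    = a≢b (c-inj (trans (sym (neighbour-parent top-a (deepest a))) (neighbour-parent top-b (deepest b))))

  path-to-root : ∀ w → Star (Adj (graph S)) w (root S w)
  path-to-root = parent-induction (λ w → Star (Adj (graph S)) w (root S w)) step
    where
    step : ∀ w → (¬ IsRoot S w → Star (Adj (graph S)) (parent S w) (root S (parent S w))) →
           Star (Adj (graph S)) w (root S w)
    step w ih with isRoot? S w
    ... | yes r = subst (Star _ w) (sym r) ε
    ... | no ¬r =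
      treeEdge⇒graph S (inj₁ (¬r , refl)) ◅ subst (Star _ (parent S w)) (root-parent wf ¬r) (ih ¬r)

  isolated-tree : ∀ {r} → (∀ z → ¬ Adj (graph S) r z) → ∀ w → root S w ≡ r → w ≡ r
  isolated-tree {r} isolated = parent-induction (λ w → root S w ≡ r → w ≡ r) step
    where
    step : ∀ w → (¬ IsRoot S w → root S (parent S w) ≡ r → parent S w ≡ r) →
           root S w ≡ r → w ≡ r
    step w ih rw≡r with isRoot? S w
    ... | yes w-root = trans (sym w-root) rw≡r
    ... | no  ¬root  = contradiction (subst (λ z → Adj (graph S) z w) p≡r w-p) (isolated w)
      where
      p≡r : parent S w ≡ r
      p≡r = ih ¬root (trans (root-parent wf ¬root) rw≡r)
      w-p : Adj (graph S) (parent S w) w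
      w-p = treeEdge⇒graph S (inj₂ (¬root , refl))

record IsRootedTree (ρ : Fin n) (S : RootedForest n) : Set where
  field
    wellFormed  : WellFormed S
    ρ-isRoot    : IsRoot S ρ
    root-unique : ∀ {w} → IsRoot S w → w ≡ ρ
open IsRootedTree

module _ {ρ : Fin n} {S : RootedForest n} (T : IsRootedTree ρ S) where

  graph-connected : Connected (graph S)
  graph-connected u v =
    path-to-root (wellFormed T) u ◅◅
    subst (λ r → Star (Adj (graph S)) r v) same-root (reverse (adj-sym S) (path-to-root (wellFormed T) v))
    where
    same-root : root S v ≡ root S u
    same-root = trans (root-unique T (root-isRoot (wellFormed T) v))
                      (sym (root-unique T (root-isRoot (wellFormed T) u)))

  graph-isSpanningTree : IsSpanningTree (graph S)
  graph-isSpanningTree = graph-isSimple (wellFormed T) , graph-connected , graph-acyclic (wellFormed T)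

differ? : (A B : Graph n) → Dec (Differ A B)
differ? A B = any? λ u → any? λ v → ¬? (A u v Bool.≟ B u v)

module _ {ρ : Fin n} {S₁ S₂ : RootedForest n}
         (T₁ : IsRootedTree ρ S₁) (T₂ : IsRootedTree ρ S₂) where

  -- If S₂ orients the edge between w and p = parent S₁ w the other way, the induction hypothesis at
  -- p makes w the S₁-parent of p as well, and depth cannot decrease along both w → p and p → w.
  parents-determined : (∀ u v → graph S₁ u v ≡ graph S₂ u v) →
                       ∀ w → w ≢ ρ → parent S₁ w ≡ parent S₂ w
  parents-determined same = parent-induction wf₁ (λ w → w ≢ ρ → parent S₁ w ≡ parent S₂ w) step
    where
    wf₁ : WellFormed S₁
    wf₁ = wellFormed T₁
    non-root₁ : ∀ {w} → w ≢ ρ → ¬ IsRoot S₁ w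
    non-root₁ w≢ρ = w≢ρ ∘ root-unique T₁
    step : ∀ w → (¬ IsRoot S₁ w → parent S₁ w ≢ ρ →
                  parent S₁ (parent S₁ w) ≡ parent S₂ (parent S₁ w)) →
           w ≢ ρ → parent S₁ w ≡ parent S₂ w
    step w ih w≢ρ
      with graph⇒treeEdge S₂ (trans (sym (same w _))
                                    (treeEdge⇒graph S₁ (inj₁ (non-root₁ w≢ρ , refl))))
    ... | inj₁ (_ , p₂≡p₁)    = sym p₂≡p₁
    ... | inj₂ (¬r₂ , p₂p₁≡w) = ⊥-elim (<-asym (depth-parent wf₁ (non-root₁ w≢ρ)) deeper)
      where
      p≢ρ : parent S₁ w ≢ ρ
      p≢ρ p≡ρ = ¬r₂ (subst (IsRoot S₂) (sym p≡ρ) (ρ-isRoot T₂))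
      p₁p₁≡w : parent S₁ (parent S₁ w) ≡ w
      p₁p₁≡w = trans (ih (non-root₁ w≢ρ) p≢ρ) p₂p₁≡w
      deeper : depth S₁ w < depth S₁ (parent S₁ w)
      deeper = subst (λ z → depth S₁ z < depth S₁ (parent S₁ w)) p₁p₁≡w
                     (depth-parent wf₁ (non-root₁ p≢ρ))

  differ-at-parent : ∀ {w} → w ≢ ρ → parent S₁ w ≢ parent S₂ w →
                     Differ (graph S₁) (graph S₂)
  differ-at-parent w≢ρ p₁≢p₂ with differ? (graph S₁) (graph S₂)
  ... | yes d  = d
  ... | no  ¬d = contradiction (parents-determined same _ w≢ρ) p₁≢p₂
    where
    same : ∀ u v → graph S₁ u v ≡ graph S₂ u v
    same u v = decidable-stable (graph S₁ u v Bool.≟ graph S₂ u v) (λ ne → ¬d (u , v , ne))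

_⊑_ : RootedForest n → RootedForest n → Set
S ⊑ T = ∀ {u v} → ChildOf S u v → ChildOf T u v

⊑-graph : {S T : RootedForest n} → S ⊑ T → graph S ⊆ᴳ graph T
⊑-graph {S = S} {T} S⊑T u v = treeEdge⇒graph T ∘ Data.Sum.map S⊑T S⊑T ∘ graph⇒treeEdge S

-- The tree rooted at r is hung below x; its depths grow by depth x + 1 so that parents stay
-- strictly shallower.
attach : RootedForest n → Fin n → Fin n → RootedForest n
attach S r x = record
  { parent = λ w → if does (w ≟ r) then x else parent S w
  ; root   = λ w → if does (root S w ≟ r) then root S x else root S w
  ; depth  = λ w → depth S w + (if does (root S w ≟ r) then suc (depth S x) else 0)
  }

module Attach {S : RootedForest n} (wf : WellFormed S) {r x : Fin n}
              (r-root : IsRoot S r) (x-outside : root S x ≢ r) where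

  S′ : RootedForest n
  S′ = attach S r x

  root-inside : ∀ {w} → root S w ≡ r → root S′ w ≡ root S x
  root-inside {w} = if-yes (root S w ≟ r)

  root-outside : ∀ {w} → root S w ≢ r → root S′ w ≡ root S w
  root-outside {w} = if-no (root S w ≟ r)

  parent-r : parent S′ r ≡ x
  parent-r = if-yes (r ≟ r) refl

  parent-other : ∀ {w} → w ≢ r → parent S′ w ≡ parent S w
  parent-other {w} = if-no (w ≟ r)

  isRoot⁺ : ∀ {w} → IsRoot S w → w ≢ r → IsRoot S′ w
  isRoot⁺ w-root w≢r = trans (root-outside (w≢r ∘ trans (sym w-root))) w-root

  isRoot⁻ : ∀ {w} → IsRoot S′ w → IsRoot S w × w ≢ r
  isRoot⁻ {w} w-root′ with root S w ≟ r
  ... | no  rw≢r = w-root′ , λ w≡r → rw≢r (trans w-root′ w≡r)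
  ... | yes rw≡r = ⊥-elim (x-outside (trans w-root′ (trans (sym w-root) rw≡r)))
    where
    w-root : IsRoot S w
    w-root = subst (IsRoot S) w-root′ (root-isRoot wf x)

  r-not-root : ¬ IsRoot S′ r
  r-not-root r-root′ = proj₂ (isRoot⁻ r-root′) refl

  S′-wellFormed : WellFormed S′
  root-isRoot S′-wellFormed w with root S w ≟ r
  ... | yes _   = isRoot⁺ (root-isRoot wf x) x-outside
  ... | no rw≢r = isRoot⁺ (root-isRoot wf w) rw≢r
  root-parent S′-wellFormed {w} ¬root′ with w ≟ r
  ... | yes refl = trans (root-outside x-outside) (sym (root-inside r-root))
  ... | no  w≢r  =
    cong (λ z → if does (z ≟ r) then root S x else z) (root-parent wf (¬root′ ∘ flip isRoot⁺ w≢r))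
  depth-parent S′-wellFormed {w} ¬root′ with w ≟ r
  ... | yes refl = subst₂ _<_ (sym depth-x) (sym depth-r) (m≤n+m (suc (depth S x)) (depth S r))
    where
    depth-x : depth S′ x ≡ depth S x
    depth-x = trans (cong (depth S x +_) (if-no (root S x ≟ r) x-outside)) (+-identityʳ _)
    depth-r : depth S′ r ≡ depth S r + suc (depth S x)
    depth-r = cong (depth S r +_) (if-yes (root S r ≟ r) r-root)
  ... | no  w≢r  =
    subst (λ z → depth S (parent S w) + shift z < depth S′ w) (sym (root-parent wf ¬root))
          (+-monoˡ-< (shift (root S w)) (depth-parent wf ¬root))
    where
    ¬root : ¬ IsRoot S w
    ¬root = ¬root′ ∘ flip isRoot⁺ w≢r
    shift : Fin n → ℕ
    shift z = if does (z ≟ r) then suc (depth S x) else 0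

  ⊑-attach : S ⊑ S′
  ⊑-attach {u} (¬root , p≡v) = ¬root ∘ proj₁ ∘ isRoot⁻ , trans (parent-other u≢r) p≡v
    where
    u≢r : u ≢ r
    u≢r u≡r = ¬root (subst (IsRoot S) (sym u≡r) r-root)

  r-childOf-x : ChildOf S′ r x
  r-childOf-x = r-not-root , parent-r

  childOf-attach⁻ : ∀ {u v} → ChildOf S′ u v → ChildOf S u v ⊎ (u ≡ r × v ≡ x)
  childOf-attach⁻ {u} (¬root′ , p≡v) with u ≟ r
  ... | yes refl = inj₂ (refl , sym p≡v)
  ... | no  u≢r  = inj₁ (¬root′ ∘ flip isRoot⁺ u≢r , p≡v)

  roots-attach : roots S ≡ suc (roots S′)
  roots-attach = count-suc-at (isRoot? S) (isRoot? S′) r r-root r-not-root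
                   (λ w w≢r → mk⇔ (flip isRoot⁺ w≢r) (proj₁ ∘ isRoot⁻))

  treeSize-attach : ∀ {ρ} → r ≢ ρ →
                    treeSize S′ ρ ≡ treeSize S ρ + indicator (does (root S x ≟ ρ)) * treeSize S r
  treeSize-attach {ρ} r≢ρ = begin
    treeSize S′ ρ                               ≡⟨ sumFin-cong pointwise ⟩
    sumFin (λ w → [≡ρ] w + c * [≡r] w)          ≡⟨ sumFin-+ [≡ρ] (λ w → c * [≡r] w) ⟩
    treeSize S ρ + sumFin (λ w → c * [≡r] w)    ≡⟨ cong (treeSize S ρ +_) (sumFin-*ˡ c [≡r]) ⟩
    treeSize S ρ + c * treeSize S r             ∎
    where
    open ≡-Reasoning
    c : ℕ
    c = indicator (does (root S x ≟ ρ))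
    [≡ρ] [≡r] : Fin n → ℕ
    [≡ρ] w = indicator (does (root S w ≟ ρ))
    [≡r] w = indicator (does (root S w ≟ r))
    pointwise : ∀ w → indicator (does (root S′ w ≟ ρ)) ≡ [≡ρ] w + c * [≡r] w
    pointwise w with root S w ≟ r
    ... | yes rw≡r =
      sym (cong₂ _+_ (cong indicator (dec-false (root S w ≟ ρ) (r≢ρ ∘ trans (sym rw≡r))))
                     (*-identityʳ c))
    ... | no  _    = sym (trans (cong ([≡ρ] w +_) (*-zeroʳ c)) (+-identityʳ _))

-- Counting completions

module Completion (ρ : Fin n) where

  DifferentTrees : Rel (RootedForest n) _
  DifferentTrees T U = Differ (graph T) (graph U)

  record Completions (S : RootedForest n) (N : ℕ) : Set where
    field
      tree      : Fin N → RootedForest n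
      isTree    : ∀ k → IsRootedTree ρ (tree k)
      extends   : ∀ k → S ⊑ tree k
      separated : Separated DifferentTrees tree
  open Completions public

  none : ∀ {S} → Completions S 0
  none = record { tree = λ () ; isTree = λ () ; extends = λ () ; separated = λ () }

  only : ∀ {S} → IsRootedTree ρ S → Completions S 1
  only {S} S-tree = record
    { tree = λ _ → S ; isTree = λ _ → S-tree ; extends = λ _ → id
    ; separated = λ { zero zero 0≢0 → contradiction refl 0≢0 } }

  weaken : ∀ {S S′ N} → S ⊑ S′ → Completions S′ N → Completions S N
  weaken S⊑S′ C = record
    { tree = tree C ; isTree = isTree C ; extends = λ k → extends C k ∘ S⊑S′
    ; separated = separated C }

  concat : ∀ {S v} → v ≢ ρ → (N : Fin n → ℕ) (C : ∀ x → Completions S (N x)) →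
           (∀ x k → parent (tree (C x) k) v ≡ x) → Completions S (sumFin N)
  concat v≢ρ N C parent-v = record
    { tree      = uncurry trees ∘ unflatten N
    ; isTree    = uncurry (isTree ∘ C) ∘ unflatten N
    ; extends   = uncurry (extends ∘ C) ∘ unflatten N
    ; separated = concat-separated {R = DifferentTrees} N trees (separated ∘ C) λ {x} {y} i j x≢y →
        differ-at-parent (isTree (C x) i) (isTree (C y) j) v≢ρ
          (λ eq → x≢y (trans (sym (parent-v x i)) (trans eq (parent-v y j))))
    }
    where
    trees : ∀ x → Fin (N x) → RootedForest n
    trees x = tree (C x)

  module _ {S : RootedForest n} (wf : WellFormed S) {v : Fin n} (v-root : IsRoot S v) (v≢ρ : v ≢ ρ) where

    weight : (x : Fin n) → Dec (root S x ≡ v) → ℕ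
    weight x (yes _)    = 0
    weight x (no x-out) = treeSize (attach S v x) ρ

    weights-sum : sumFin (λ x → weight x (root S x ≟ v)) ≡ treeSize S ρ * n
    weights-sum = begin
      sumFin (λ x → weight x (root S x ≟ v))
        ≡⟨ sumFin-cong pointwise ⟩
      sumFin (λ x → u * [≢v] x + b * [≡ρ] x)
        ≡⟨ sumFin-+ (λ x → u * [≢v] x) (λ x → b * [≡ρ] x) ⟩
      sumFin (λ x → u * [≢v] x) + sumFin (λ x → b * [≡ρ] x)
        ≡⟨ cong₂ _+_ (sumFin-*ˡ u [≢v]) (sumFin-*ˡ b [≡ρ]) ⟩
      u * sumFin [≢v] + b * u
        ≡⟨ trans (+-comm _ (b * u)) (cong (_+ u * sumFin [≢v]) (*-comm b u)) ⟩
      u * b + u * sumFin [≢v]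
        ≡⟨ *-distribˡ-+ u b (sumFin [≢v]) ⟨
      u * (b + sumFin [≢v])
        ≡⟨ cong (u *_) (count-complement (λ x → root S x ≟ v)) ⟩
      u * n ∎
      where
      open ≡-Reasoning
      u b : ℕ
      u = treeSize S ρ
      b = treeSize S v
      [≢v] [≡ρ] : Fin n → ℕ
      [≢v] x = indicator (not (does (root S x ≟ v)))
      [≡ρ] x = indicator (does (root S x ≟ ρ))
      pointwise : ∀ x → weight x (root S x ≟ v) ≡ u * [≢v] x + b * [≡ρ] x
      pointwise x with root S x ≟ v
      ... | yes rx≡v  =
        sym (cong₂ _+_ (*-zeroʳ u) (trans (cong (b *_) (cong indicator x∉ρ)) (*-zeroʳ b)))
        where
        x∉ρ : does (root S x ≟ ρ) ≡ false
        x∉ρ = dec-false (root S x ≟ ρ) (v≢ρ ∘ trans (sym rx≡v))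
      ... | no  x-out =
        trans (Attach.treeSize-attach wf v-root x-out v≢ρ) (cong₂ _+_ (sym (*-identityʳ u)) (*-comm _ b))

  -- A forest with R + 1 roots has exactly n ^ (R - 1) · ∏ (tree sizes) completions.  The bound keeps
  -- only the factor of the tree of ρ and is multiplied through by n, so that R = 0 fits the same form.
  EnoughCompletions : ℕ → RootedForest n → Set
  EnoughCompletions R S = Σ ℕ λ N → Completions S N × treeSize S ρ * n ^ R ≤ n * N

  completions-single : ∀ {S} → WellFormed S → IsRoot S ρ → roots S ≡ 1 → EnoughCompletions 0 S
  completions-single {S} wf ρ-root roots≡1 =
    1 , only S-tree , *-monoˡ-≤ 1 (count-≤ (λ w → root S w ≟ ρ))
    where
    unique : ∀ {w} → IsRoot S w → w ≡ ρ
    unique {w} w-root = decidable-stable (w ≟ ρ) λ w≢ρ →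
      <-irrefl refl (subst (1 <_) roots≡1 (count-≥2 (isRoot? S) w-root ρ-root w≢ρ))
    S-tree : IsRootedTree ρ S
    S-tree = record { wellFormed = wf ; ρ-isRoot = ρ-root ; root-unique = unique }

  completions-step : ∀ {R} →
                     (∀ {S′} → WellFormed S′ → IsRoot S′ ρ → roots S′ ≡ suc R → EnoughCompletions R S′) →
                     ∀ {S} → WellFormed S → IsRoot S ρ → ∀ {v} → IsRoot S v → v ≢ ρ →
                     roots S ≡ suc (suc R) → EnoughCompletions (suc R) S
  completions-step {R} completions′ {S} wf ρ-root {v} v-root v≢ρ roots≡ =
    sumFin N , concat v≢ρ N C parent-v , bound
    where
    branch : ∀ x (d : Dec (root S x ≡ v)) → Σ ℕ λ N → Σ (Completions S N) λ C →
             (∀ k → parent (tree C k) v ≡ x) × weight wf v-root v≢ρ x d * n ^ R ≤ n * N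
    branch x (yes _)    = 0 , none , (λ ()) , z≤n
    branch x (no x-out) = hang (completions′ S′-wellFormed (isRoot⁺ ρ-root (v≢ρ ∘ sym))
                                             (cong pred (trans (sym roots-attach) roots≡)))
      where
      open Attach wf v-root x-out
      hang : EnoughCompletions R S′ → Σ ℕ λ N → Σ (Completions S N) λ C →
             (∀ k → parent (tree C k) v ≡ x) × treeSize S′ ρ * n ^ R ≤ n * N
      hang (N , C , bound) = N , weaken ⊑-attach C , (λ k → proj₂ (extends C k r-childOf-x)) , bound
    N : Fin n → ℕ
    N x = proj₁ (branch x (root S x ≟ v))
    C : ∀ x → Completions S (N x)
    C x = proj₁ (proj₂ (branch x (root S x ≟ v)))
    parent-v : ∀ x k → parent (tree (C x) k) v ≡ x
    parent-v x = proj₁ (proj₂ (proj₂ (branch x (root S x ≟ v))))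
    weight′ : Fin n → ℕ
    weight′ x = weight wf v-root v≢ρ x (root S x ≟ v)
    branch-bound : ∀ x → weight′ x * n ^ R ≤ n * N x
    branch-bound x = proj₂ (proj₂ (proj₂ (branch x (root S x ≟ v))))
    bound : treeSize S ρ * n ^ suc R ≤ n * sumFin N
    bound = begin
      treeSize S ρ * (n * n ^ R)        ≡⟨ *-assoc (treeSize S ρ) n (n ^ R) ⟨
      treeSize S ρ * n * n ^ R          ≡⟨ cong (_* n ^ R) (weights-sum wf v-root v≢ρ) ⟨
      sumFin weight′ * n ^ R            ≡⟨ sumFin-*ʳ weight′ (n ^ R) ⟨
      sumFin (λ x → weight′ x * n ^ R)  ≤⟨ sumFin-mono branch-bound ⟩
      sumFin (λ x → n * N x)            ≡⟨ sumFin-*ˡ n N ⟩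
      n * sumFin N                      ∎
      where open ≤-Reasoning

  completions : ∀ R {S} → WellFormed S → IsRoot S ρ → roots S ≡ suc R → EnoughCompletions R S
  completions zero    wf ρ-root roots≡ = completions-single wf ρ-root roots≡
  completions (suc R) {S} wf ρ-root roots≡ with any? (λ v → isRoot? S v ×-dec ¬? (v ≟ ρ))
  ... | yes (v , v-root , v≢ρ) = completions-step (completions R) wf ρ-root v-root v≢ρ roots≡
  ... | no  ¬other             =
    contradiction (subst (_≤ 1) roots≡ (count-≤1 (isRoot? S) ρ unique)) λ { (s≤s ()) }
    where
    unique : ∀ w → IsRoot S w → w ≡ ρ
    unique w w-root = decidable-stable (w ≟ ρ) λ w≢ρ → ¬other (w , w-root , w≢ρ)

-- Removing an edge, and the leaves of a forest

SameEdge : Fin n → Fin n → Fin n → Fin n → Set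
SameEdge a b u v = (u ≡ a × v ≡ b) ⊎ (u ≡ b × v ≡ a)

sameEdge? : (a b u v : Fin n) → Dec (SameEdge a b u v)
sameEdge? a b u v = (u ≟ a ×-dec v ≟ b) ⊎-dec (u ≟ b ×-dec v ≟ a)

removeEdge : Graph n → Fin n → Fin n → Graph n
removeEdge F a b u v = F u v ∧ not (does (sameEdge? a b u v))

module _ (F : Graph n) (a b : Fin n) where

  removeEdge-⊆ : removeEdge F a b ⊆ᴳ F
  removeEdge-⊆ u v = proj₁ ∘ ∧-true⁻ (F u v)
    where
    ∧-true⁻ : ∀ x {y} → x ∧ y ≡ true → x ≡ true × y ≡ true
    ∧-true⁻ true refl = refl , refl

  removeEdge-keeps : ∀ {u v} → ¬ SameEdge a b u v → removeEdge F a b u v ≡ F u v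
  removeEdge-keeps {u} {v} ¬same =
    trans (cong (λ z → F u v ∧ not z) (dec-false (sameEdge? a b u v) ¬same)) (∧-identityʳ (F u v))

  removeEdge-removes : ∀ {u v} → SameEdge a b u v → removeEdge F a b u v ≡ false
  removeEdge-removes {u} {v} same =
    trans (cong (λ z → F u v ∧ not z) (dec-true (sameEdge? a b u v) same)) (∧-zeroʳ (F u v))

  removeEdge-comm : ∀ u v → removeEdge F a b u v ≡ removeEdge F b a u v
  removeEdge-comm u v =
    cong (λ z → F u v ∧ not z) (∨-comm (does (u ≟ a ×-dec v ≟ b)) (does (u ≟ b ×-dec v ≟ a)))

acyclic-⊆ : {A B : Graph n} → A ⊆ᴳ B → Acyclic B → Acyclic A
acyclic-⊆ A⊆B B-acyclic (k , c , c-inj , step , close) =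
  B-acyclic (k , c , c-inj , A⊆B _ _ ∘ step , A⊆B _ _ close)

removeEdge-isForest : {F : Graph n} → IsForest F → ∀ a b → IsForest (removeEdge F a b)
removeEdge-isForest {F = F} ((F-sym , F-loopless) , F-acyclic) a b =
  (sym′ , (λ u → cong (_∧ _) (F-loopless u))) , acyclic-⊆ (removeEdge-⊆ F a b) F-acyclic
  where
  swap : ∀ {u v} → SameEdge a b u v → SameEdge a b v u
  swap = [ inj₂ ∘ Data.Product.swap , inj₁ ∘ Data.Product.swap ]′
  sym′ : ∀ u v → removeEdge F a b u v ≡ removeEdge F a b v u
  sym′ u v = cong₂ (λ x y → x ∧ not y) (F-sym u v)
                   (does-⇔ (mk⇔ swap swap) (sameEdge? a b u v) (sameEdge? a b v u))

edgeCount-cong : {A B : Graph n} → (∀ u v → A u v ≡ B u v) → edgeCount A ≡ edgeCount B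
edgeCount-cong A≗B =
  sumFin-cong λ i → sumFin-cong λ j → cong (λ z → indicator ((toℕ i <ᵇ toℕ j) ∧ z)) (A≗B i j)

-- Only the cell (a, b) of edgeCount changes: the cell (b, a) is not counted because b > a.
edgeCount-removeEdge< : (F : Graph n) {a b : Fin n} → toℕ a < toℕ b → F a b ≡ true →
                        edgeCount F ≡ suc (edgeCount (removeEdge F a b))
edgeCount-removeEdge< {n} F {a} {b} a<b Fab =
  sumFin-suc-at a (sumFin-suc-at b cell-ab (λ j j≢b → cell-other {a} {j} (j≢b ∘ proj₂)))
                  (λ i i≢a → sumFin-cong λ j → cell-other {i} {j} (i≢a ∘ proj₁))
  where
  F′ : Graph n
  F′ = removeEdge F a b
  cell : Graph n → Fin n → Fin n → ℕ
  cell G i j = indicator ((toℕ i <ᵇ toℕ j) ∧ G i j)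
  a<ᵇb : (toℕ a <ᵇ toℕ b) ≡ true
  a<ᵇb = dec-true (toℕ a <? toℕ b) a<b
  cell-ab : cell F a b ≡ suc (cell F′ a b)
  cell-ab = trans (cong₂ (λ x y → indicator (x ∧ y)) a<ᵇb Fab) (cong (suc ∘ indicator) (sym no-ab))
    where
    no-ab : (toℕ a <ᵇ toℕ b) ∧ F′ a b ≡ false
    no-ab = trans (cong ((toℕ a <ᵇ toℕ b) ∧_) (removeEdge-removes F a b (inj₁ (refl , refl))))
                  (∧-zeroʳ (toℕ a <ᵇ toℕ b))
  cell-other : ∀ {i j} → ¬ (i ≡ a × j ≡ b) → cell F i j ≡ cell F′ i j
  cell-other {i} {j} ≢ab with sameEdge? a b i j
  ... | yes (inj₁ ≡ab)           = contradiction ≡ab ≢ab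
  ... | yes (inj₂ (refl , refl)) rewrite dec-false (toℕ b <? toℕ a) (<-asym a<b) = refl
  ... | no  ¬same                =
    cong (λ z → indicator ((toℕ i <ᵇ toℕ j) ∧ z)) (sym (removeEdge-keeps F a b ¬same))

edgeCount-removeEdge : (F : Graph n) → IsSimple F → ∀ {a b} → F a b ≡ true →
                       edgeCount F ≡ suc (edgeCount (removeEdge F a b))
edgeCount-removeEdge F (F-sym , F-loopless) {a} {b} Fab with <-cmp (toℕ a) (toℕ b)
... | tri< a<b _ _ = edgeCount-removeEdge< F a<b Fab
... | tri≈ _ a≡b _ =
  contradiction (trans (sym (F-loopless a)) (subst (Adj F a) (sym (toℕ-injective a≡b)) Fab)) λ ()
... | tri> _ _ b<a = trans (edgeCount-removeEdge< F b<a (trans (F-sym b a) Fab))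
                           (cong suc (edgeCount-cong (removeEdge-comm F b a)))

module _ {F : Graph n} (F-loopless : ∀ w → F w w ≡ false) where

  -- Closed walks of length 1 and 2 are excluded by looplessness and by not backtracking.
  closed-walk-cycle : (w : ℕ → Fin n) → (∀ t → Adj F (w t) (w (suc t))) →
                      (∀ t → w (2 + t) ≢ w t) → ∀ d → w (suc d) ≡ w 0 →
                      (∀ {a b} → a ≤ d → b ≤ d → w a ≡ w b → a ≡ b) → HasCycle F
  closed-walk-cycle w step no-backtrack zero closed _ =
    contradiction (trans (sym (F-loopless (w 0))) (subst (Adj F (w 0)) closed (step 0))) λ ()
  closed-walk-cycle w step no-backtrack (suc zero) closed _ = contradiction closed (no-backtrack 0)
  closed-walk-cycle w step no-backtrack (suc (suc k)) closed injective =
    k , c , c-injective , c-step , c-close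
    where
    c : Fin (3 + k) → Fin n
    c t = w (toℕ t)
    c-injective : ∀ {s t} → c s ≡ c t → s ≡ t
    c-injective {s} {t} = toℕ-injective ∘ injective (s≤s⁻¹ (toℕ<n s)) (s≤s⁻¹ (toℕ<n t))
    c-step : ∀ (t : Fin (2 + k)) → Adj F (c (inject₁ t)) (c (suc t))
    c-step t = subst (λ s → Adj F (w s) (w (suc (toℕ t)))) (sym (toℕ-inject₁ t)) (step (toℕ t))
    c-close : Adj F (c (fromℕ (2 + k))) (c zero)
    c-close = subst₂ (λ s z → Adj F (w s) z) (sym (toℕ-fromℕ (2 + k))) closed (step (2 + k))

  module _ (branching : ∀ {p q} → Adj F p q → ∃ λ z → Adj F q z × z ≢ p) where

    DirectedEdge : Set
    DirectedEdge = ∃₂ λ p q → Adj F p q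

    advance : DirectedEdge → DirectedEdge
    advance (p , q , pq) = q , proj₁ (branching pq) , proj₁ (proj₂ (branching pq))

    vertex : DirectedEdge → ℕ → Fin n
    vertex e t = proj₁ (iterate advance e t)

    vertex-step : ∀ e t → Adj F (vertex e t) (vertex e (suc t))
    vertex-step (_ , _ , pq) zero    = pq
    vertex-step e            (suc t) = vertex-step (advance e) t

    vertex-no-backtrack : ∀ e t → vertex e (2 + t) ≢ vertex e t
    vertex-no-backtrack (_ , _ , pq) zero    = proj₂ (proj₂ (branching pq))
    vertex-no-backtrack e            (suc t) = vertex-no-backtrack (advance e) t

    module _ (e : DirectedEdge) where

      Repeats : Pred ℕ _
      Repeats j = ∃ λ i → i < j × vertex e i ≡ vertex e j

      first-repeat : ∃ λ j → Repeats j × (∀ {k} → k < j → ¬ Repeats k)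
      first-repeat with i , j , i<j , repeat ← pigeonhole (n<1+n n) (vertex e ∘ toℕ) =
        least-witness (λ j → anyUpTo? (λ i → vertex e i ≟ vertex e j) j) (toℕ i , i<j , repeat)

      injective-before : ∀ {j} → (∀ {k} → k < j → ¬ Repeats k) →
                         ∀ {a b} → a < j → b < j → vertex e a ≡ vertex e b → a ≡ b
      injective-before first {a} {b} a<j b<j eq with <-cmp a b
      ... | tri< a<b _ _ = contradiction (a , a<b , eq) (first b<j)
      ... | tri≈ _ a≡b _ = a≡b
      ... | tri> _ _ b<a = contradiction (b , b<a , sym eq) (first a<j)

      cycle-from-repeat : ∀ i d → vertex e i ≡ vertex e (suc i + d) →
                          (∀ {k} → k < suc i + d → ¬ Repeats k) → HasCycle F
      cycle-from-repeat i d repeat first =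
        closed-walk-cycle (vertex e′) (vertex-step e′) (vertex-no-backtrack e′) d closed injective
        where
        e′ : DirectedEdge
        e′ = iterate advance e i
        shift : ∀ t → vertex e′ t ≡ vertex e (i + t)
        shift t = cong proj₁ (sym (iterate-+ advance e i t))
        closed : vertex e′ (suc d) ≡ vertex e′ 0
        closed = begin
          vertex e′ (suc d)     ≡⟨ shift (suc d) ⟩
          vertex e (i + suc d)  ≡⟨ cong (vertex e) (+-suc i d) ⟩
          vertex e (suc i + d)  ≡⟨ repeat ⟨
          vertex e i            ≡⟨ cong (vertex e) (+-identityʳ i) ⟨
          vertex e (i + 0)      ≡⟨ shift 0 ⟨
          vertex e′ 0           ∎
          where open ≡-Reasoning
        injective : ∀ {a b} → a ≤ d → b ≤ d → vertex e′ a ≡ vertex e′ b → a ≡ b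
        injective a≤d b≤d eq = +-cancelˡ-≡ i _ _
          (injective-before first (s≤s (+-monoʳ-≤ i a≤d)) (s≤s (+-monoʳ-≤ i b≤d))
                            (trans (sym (shift _)) (trans eq (shift _))))

      branching-cycle : HasCycle F
      branching-cycle with j , (i , i<j , repeat) , first ← first-repeat
                      with d , refl ← m≤n⇒∃[o]m+o≡n i<j
        = cycle-from-repeat i d repeat first

IsLeafAt : Graph n → Fin n → Fin n → Set
IsLeafAt F l y = Adj F l y × (∀ z → Adj F l z → z ≡ y)

isLeafAt? : (F : Graph n) (l y : Fin n) → Dec (IsLeafAt F l y)
isLeafAt? F l y = (F l y Bool.≟ true) ×-dec all? (λ z → (F l z Bool.≟ true) →-dec (z ≟ y))

forest-leaf : {F : Graph n} → IsForest F → ∀ {u v} → Adj F u v → ∃₂ (IsLeafAt F)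
forest-leaf {F = F} (F-simple , F-acyclic) uv with any? (λ l → any? (isLeafAt? F l))
... | yes leaf = leaf
... | no ¬leaf = contradiction (branching-cycle (proj₂ F-simple) branching (_ , _ , uv)) F-acyclic
  where
  branching : ∀ {p q} → Adj F p q → ∃ λ z → Adj F q z × z ≢ p
  branching {p} {q} pq with any? (λ z → (F q z Bool.≟ true) ×-dec ¬? (z ≟ p))
  ... | yes other = other
  ... | no  none  = contradiction (q , p , trans (proj₁ F-simple q p) pq , only-p) ¬leaf
    where
    only-p : ∀ z → Adj F q z → z ≡ p
    only-p z qz = decidable-stable (z ≟ p) λ z≢p → none (z , qz , z≢p)

-- Rooting a forest

record Rooting (F : Graph n) : Set where
  field
    forest      : RootedForest n
    wellFormed  : WellFormed forest
    graph-⊆     : graph forest ⊆ᴳ F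
    ⊆-graph     : F ⊆ᴳ graph forest
    roots-bound : n ≤ roots forest + edgeCount F

discrete : RootedForest n
discrete = record { parent = id ; root = id ; depth = λ _ → 0 }

discrete-rooting : {F : Graph n} → (∀ u v → ¬ Adj F u v) → Rooting F
discrete-rooting {n} {F} no-edges = record
  { forest      = discrete
  ; wellFormed  = record { root-isRoot  = λ _ → refl
                         ; root-parent  = λ ¬root → contradiction refl ¬root
                         ; depth-parent = λ ¬root → contradiction refl ¬root }
  ; graph-⊆     = λ u v → ⊥-elim ∘ no-discrete-edge ∘ graph⇒treeEdge discrete {u} {v}
  ; ⊆-graph     = λ u v → ⊥-elim ∘ no-edges u v
  ; roots-bound = subst (λ r → n ≤ r + edgeCount F) (sym (count-all (isRoot? discrete) (λ _ → refl)))
                        (m≤m+n n (edgeCount F))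
  }
  where
  no-discrete-edge : ∀ {u v} → ¬ TreeEdge discrete u v
  no-discrete-edge = [ (λ (¬root , _) → ¬root refl) , (λ (¬root , _) → ¬root refl) ]′

-- The leaf l is isolated in the rooting of F with the edge l y removed, so it is a root there and
-- can be hung below y.
module _ {F : Graph n} (F-simple : IsSimple F) {l y : Fin n} (leaf : IsLeafAt F l y) where

  private
    F′ : Graph n
    F′ = removeEdge F l y

  rooting-leaf : Rooting F′ → Rooting F
  rooting-leaf R′ = record
    { forest      = S′
    ; wellFormed  = S′-wellFormed
    ; graph-⊆     = λ u v → [ childOf-⊆ , sym-adj ∘ childOf-⊆ ]′ ∘ graph⇒treeEdge S′
    ; ⊆-graph     = ⊆-graph′
    ; roots-bound = subst (n ≤_) bound-eq (Rooting.roots-bound R′)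
    }
    where
    ly : Adj F l y
    ly = proj₁ leaf
    only-y : ∀ z → Adj F l z → z ≡ y
    only-y = proj₂ leaf
    S₀ : RootedForest n
    S₀ = Rooting.forest R′
    wf₀ : WellFormed S₀
    wf₀ = Rooting.wellFormed R′
    sym-adj : ∀ {u v} → Adj F u v → Adj F v u
    sym-adj {u} {v} = trans (proj₁ F-simple v u)
    l≢y : l ≢ y
    l≢y refl = contradiction (trans (sym (proj₂ F-simple l)) ly) λ ()
    isolated : ∀ z → ¬ Adj (graph S₀) l z
    isolated z lz = contradiction (trans (sym (removeEdge-removes F l y (inj₁ (refl , refl)))) F′ly) λ ()
      where
      F′lz : Adj F′ l z
      F′lz = Rooting.graph-⊆ R′ l z lz
      F′ly : Adj F′ l y
      F′ly = subst (Adj F′ l) (only-y z (removeEdge-⊆ F l y l z F′lz)) F′lz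
    l-root : IsRoot S₀ l
    l-root = decidable-stable (isRoot? S₀ l) λ ¬root →
      isolated _ (treeEdge⇒graph S₀ (inj₁ (¬root , refl)))
    y-outside : root S₀ y ≢ l
    y-outside ry≡l = l≢y (sym (isolated-tree wf₀ isolated y ry≡l))
    open Attach wf₀ l-root y-outside
    childOf-⊆ : ∀ {u v} → ChildOf S′ u v → Adj F u v
    childOf-⊆ c with childOf-attach⁻ c
    ... | inj₁ c₀            =
      removeEdge-⊆ F l y _ _ (Rooting.graph-⊆ R′ _ _ (treeEdge⇒graph S₀ (inj₁ c₀)))
    ... | inj₂ (refl , refl) = ly
    ⊆-graph′ : F ⊆ᴳ graph S′
    ⊆-graph′ u v uv with sameEdge? l y u v
    ... | yes (inj₁ (refl , refl)) = treeEdge⇒graph S′ (inj₁ r-childOf-x)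
    ... | yes (inj₂ (refl , refl)) = treeEdge⇒graph S′ (inj₂ r-childOf-x)
    ... | no  ¬same                =
      ⊑-graph {S = S₀} {S′} ⊑-attach u v
              (Rooting.⊆-graph R′ u v (trans (removeEdge-keeps F l y ¬same) uv))
    bound-eq : roots S₀ + edgeCount F′ ≡ roots S′ + edgeCount F
    bound-eq = begin
      roots S₀ + edgeCount F′        ≡⟨ cong (_+ edgeCount F′) roots-attach ⟩
      suc (roots S′) + edgeCount F′  ≡⟨ +-suc (roots S′) (edgeCount F′) ⟨
      roots S′ + suc (edgeCount F′)  ≡⟨ cong (roots S′ +_) (edgeCount-removeEdge F F-simple ly) ⟨
      roots S′ + edgeCount F         ∎
      where open ≡-Reasoning

rooting : ∀ c {F : Graph n} → IsForest F → edgeCount F ≡ c → Rooting F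
rooting c {F} F-forest count≡c with any? (λ u → any? (λ v → F u v Bool.≟ true))
... | no  ¬edge          = discrete-rooting (λ u v uv → ¬edge (u , v , uv))
... | yes (u , v , uv) with forest-leaf F-forest uv
...   | l , y , leaf@(ly , _) with edgeCount-removeEdge F (proj₁ F-forest) ly | c
...     | count≡ | zero   = contradiction (trans (sym count≡) count≡c) λ ()
...     | count≡ | suc c′ =
  rooting-leaf (proj₁ F-forest) leaf
    (rooting c′ (removeEdge-isForest F-forest l y) (cong pred (trans (sym count≡) count≡c)))

exponent-bound : ∀ {n e} r → n ≤ suc r + e → n ∸ e ∸ 2 ≤ r ∸ 1
exponent-bound {n} {e} r n≤ =
  ∸-monoˡ-≤ 2 (≤-trans (∸-monoˡ-≤ e n≤) (≤-reflexive (m+n∸n≡m (suc r) e)))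

power-bound : ∀ {n u N} .{{_ : NonZero n}} r → 1 ≤ u → u * n ^ r ≤ n * N → n ^ (r ∸ 1) ≤ N
power-bound {n} {u} {zero}  zero    1≤u bound = contradiction (begin
  1       ≤⟨ 1≤u ⟩
  u       ≡⟨ *-identityʳ u ⟨
  u * 1   ≤⟨ bound ⟩
  n * 0   ≡⟨ *-zeroʳ n ⟩
  0       ∎) λ ()
  where open ≤-Reasoning
power-bound {n} {u} {suc N} zero    1≤u bound = s≤s z≤n
power-bound {n} {u} {N}     (suc r) 1≤u bound = *-cancelˡ-≤ n (begin
  n ^ suc r          ≡⟨ *-identityˡ (n ^ suc r) ⟨
  1 * n ^ suc r      ≤⟨ *-monoˡ-≤ (n ^ suc r) 1≤u ⟩
  u * n ^ suc r      ≤⟨ bound ⟩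
  n * N              ∎)
  where open ≤-Reasoning

SpanningTreesContaining : Graph n → ℕ → Set
SpanningTreesContaining {n} F N =
  Σ (Fin N → Graph n) λ T → (∀ k → IsSpanningTree (T k) × F ⊆ᴳ T k) × Separated Differ T

fewer : {F : Graph n} {N N′ : ℕ} → N′ ≤ N →
        SpanningTreesContaining F N → SpanningTreesContaining F N′
fewer {N = N} {N′} N′≤N (T , spanning , separated) =
  T ∘ pick , spanning ∘ pick ,
  λ k l k≢l → separated (pick k) (pick l) (k≢l ∘ inject≤-injective N′≤N N′≤N k l)
  where
  pick : Fin N′ → Fin N
  pick k = inject≤ k N′≤N

module _ {F : Graph n} (R : Rooting F) {ρ : Fin n} {N : ℕ} where
  open Completion ρ

  completions⇒spanningTrees : Completions (Rooting.forest R) N → SpanningTreesContaining F N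
  completions⇒spanningTrees C =
    graph ∘ tree C ,
    (λ k → graph-isSpanningTree (isTree C k) , F⊆tree k) ,
    separated C
    where
    F⊆tree : ∀ k → F ⊆ᴳ graph (tree C k)
    F⊆tree k u v = ⊑-graph {S = Rooting.forest R} {tree C k} (extends C k) u v ∘ Rooting.⊆-graph R u v

forest-spanningTrees : {F : Graph (suc n)} → IsForest F →
                       ∃ λ N → SpanningTreesContaining F N × suc n ^ (suc n ∸ edgeCount F ∸ 2) ≤ N
forest-spanningTrees {n} {F} F-forest =
  proj₁ result , completions⇒spanningTrees R (proj₁ (proj₂ result)) , many
  where
  R : Rooting F
  R = rooting _ F-forest refl
  S : RootedForest (suc n)
  S = Rooting.forest R
  wf : WellFormed S
  wf = Rooting.wellFormed R
  ρ : Fin (suc n)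
  ρ = root S zero
  ρ-root : IsRoot S ρ
  ρ-root = root-isRoot wf zero
  r : ℕ
  r = pred (roots S)
  roots≡ : roots S ≡ suc r
  roots≡ = sym (suc-pred (roots S) ⦃ >-nonZero (count-≥1 (isRoot? S) ρ ρ-root) ⦄)
  result : Completion.EnoughCompletions ρ r S
  result = Completion.completions ρ r wf ρ-root roots≡
  many : suc n ^ (suc n ∸ edgeCount F ∸ 2) ≤ proj₁ result
  many = ≤-trans (^-monoʳ-≤ (suc n) (exponent-bound r (subst (λ x → suc n ≤ x + edgeCount F) roots≡
                                                             (Rooting.roots-bound R))))
                 (power-bound r (count-≥1 (λ w → root S w ≟ ρ) ρ ρ-root) (proj₂ (proj₂ result)))

-- For n = 0 the bound is 0 ^ 0 = 1, and the empty graph is the one spanning tree.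
empty-isSpanningTree : IsSpanningTree {0} (λ ())
empty-isSpanningTree = ((λ ()) , (λ ())) , (λ ()) , λ (_ , c , _) → Fin0⇒⊥ (c zero)
  where
  Fin0⇒⊥ : Fin 0 → ⊥
  Fin0⇒⊥ ()

corollary2p3 : (n : ℕ) (F : Graph n) → IsForest F →
    Σ (Fin (n ^ (n ∸ edgeCount F ∸ 2)) → Graph n) λ T →
      (∀ k → IsSpanningTree (T k) × F ⊆ᴳ T k)
      × (∀ k l → k ≢ l → Differ (T k) (T l))
corollary2p3 zero F _ =
  (λ _ ()) , (λ _ → empty-isSpanningTree , λ ()) , λ { zero zero 0≢0 → contradiction refl 0≢0 }
corollary2p3 (suc n) F F-forest with N , trees , many ← forest-spanningTrees F-forest = fewer many trees
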